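{- Let $G=(V_1\cup V_2,E)$ be a bipartite graph with parts $V_1,V_2$, $|V_1|=|V_2|=n$, $m=|E|$, $V=V_1\cup V_2$, and fix an ordering $v_0,\dots,v_{n-1}$ of $V_2$. For $0\le i\le n-1$ let $V^i=\{v_i,v_{i+1},\dots,v_{n-1}\}\cup V_1$. Let $S\subseteq V_1$, let $0\le i\le n-2$, and let $l=|c(v_i,V_1\setminus S)|-|c(v_i,S)|$. Then $W_{S|V^{i+1}}=W_{S|V^i}+\sigma_l(W_{S|V^i})$.
   Context: For disjoint vertex sets $A,B$, $c(A,B)$ is the set of edges with one endpoint in $A$ and the other in $B$; $c(v,B)$ means $c(\{v\},B)$. For $S'\subseteq V'\subseteq V$, $\mathcal{P}_{S'|V'}$ is the set of subsets $S\subseteq V$ with $S\supseteq S'$ and $V\setminus S\supseteq V'\setminus S'$, and $W_{S'|V'}\in\mathbb{Z}^{\{0,\dots,m\}}$ is the vector with $W_{S'|V'}[k]=|\{S\in\mathcal{P}_{S'|V'}: |c(S,V\setminus S)|=k\}|$. For a vector $W$ indexed by $\{0,\dots,m\}$ and an integer $x$, $\sigma_x(W)$ is the vector indexed by $\{0,\dots,m\}$ with $\sigma_x(W)[k]=W[k-x]$ if $0\le k-x\le m$ and $\sigma_x(W)[k]=0$ otherwise. -}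

module Defs where

open import Data.Bool using (Bool; true; false; not; _∧_; _∨_; _xor_; if_then_else_)
open import Data.Nat using (ℕ; zero; suc; _≤ᵇ_; _≡ᵇ_; _<?_)
open import Data.Fin using (Fin; toℕ; fromℕ<) renaming (_≟_ to _≟ᶠ_)
open import Data.Integer using (ℤ; +_; -[1+_]; _-_)
open import Data.List using (List; []; _∷_; map; length; filterᵇ; allFin; cartesianProduct; _++_)
open import Data.Bool.ListAction using (any; all)
open import Data.Vec using (Vec; []; _∷_; lookup; replicate; tabulate)
open import Data.Sum using (_⊎_; inj₁; inj₂)
open import Data.Product using (_×_; _,_; proj₁; proj₂)
open import Relation.Nullary using (yes; no)
open import Relation.Nullary.Decidable using (⌊_⌋)

-- A bipartite graph with parts V₁ = V₂ = Fin n (two disjoint copies).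
-- E a b = true iff there is an edge between a ∈ V₁ and b ∈ V₂.
Graph : ℕ → Set
Graph n = Fin n → Fin n → Bool

Vtx : ℕ → Set
Vtx n = Fin n ⊎ Fin n

allVtx : (n : ℕ) → List (Vtx n)
allVtx n = map inj₁ (allFin n) ++ map inj₂ (allFin n)

-- A subset of V, given by its characteristic vectors on V₁ and on V₂.
Sub : ℕ → Set
Sub n = Vec Bool n × Vec Bool n

_∈ᵇ_ : {n : ℕ} → Vtx n → Sub n → Bool
inj₁ a ∈ᵇ S = lookup (proj₁ S) a
inj₂ b ∈ᵇ S = lookup (proj₂ S) b

allVecs : (k : ℕ) → List (Vec Bool k)
allVecs zero = [] ∷ []
allVecs (suc k) = map (true ∷_) (allVecs k) ++ map (false ∷_) (allVecs k)

allSubs : (n : ℕ) → List (Sub n)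
allSubs n = cartesianProduct (allVecs n) (allVecs n)

countᵇ : {A : Set} → (A → Bool) → List A → ℕ
countᵇ p xs = length (filterᵇ p xs)

numEdges : {n : ℕ} → Graph n → ℕ
numEdges {n} E = countᵇ (λ ab → E (proj₁ ab) (proj₂ ab)) (cartesianProduct (allFin n) (allFin n))

cutSize : {n : ℕ} → Graph n → Sub n → ℕ
cutSize {n} E S =
  countᵇ (λ ab → E (proj₁ ab) (proj₂ ab) ∧ ((inj₁ (proj₁ ab) ∈ᵇ S) xor (inj₂ (proj₂ ab) ∈ᵇ S)))
         (cartesianProduct (allFin n) (allFin n))

-- S ∈ 𝒫_{S'|V'}  iff  S ⊇ S'  and  V ∖ S ⊇ V' ∖ S'
inP : {n : ℕ} → Sub n → Sub n → Sub n → Bool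
inP {n} S' V' S =
  all (λ v → (not (v ∈ᵇ S') ∨ (v ∈ᵇ S))
           ∧ (not ((v ∈ᵇ V') ∧ not (v ∈ᵇ S')) ∨ not (v ∈ᵇ S)))
      (allVtx n)

W : {n : ℕ} → (E : Graph n) → Sub n → Sub n → Fin (suc (numEdges E)) → ℕ
W {n} E S' V' k = countᵇ (λ S → inP S' V' S ∧ (cutSize E S ≡ᵇ toℕ k)) (allSubs n)

σ : (m : ℕ) → ℤ → (Fin (suc m) → ℕ) → Fin (suc m) → ℕ
σ m x w k with (+ toℕ k) - x
... | -[1+ _ ] = 0
... | + j with j <? suc m
...   | yes p = w (fromℕ< p)
...   | no _ = 0

embed₁ : {n : ℕ} → Vec Bool n → Sub n
embed₁ {n} S₁ = (S₁ , replicate n false)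

-- V^i = {v_i, …, v_{n-1}} ∪ V₁, where v_j = ord j is the ordering of V₂
Vsup : {n : ℕ} → (Fin n → Fin n) → ℕ → Sub n
Vsup {n} ord i =
  ( replicate n true
  , tabulate (λ b → any (λ j → (i ≤ᵇ toℕ j) ∧ ⌊ ord j ≟ᶠ b ⌋) (allFin n)) )

ldiff : {n : ℕ} → Graph n → Vec Bool n → Fin n → ℤ
ldiff {n} E S₁ v =
  + countᵇ (λ a → E a v ∧ not (lookup S₁ a)) (allFin n)
  - + countᵇ (λ a → E a v ∧ lookup S₁ a) (allFin n)

-- Split 𝒫_{S|V^{i+1}} according to whether v_i belongs to the set. The sets avoiding v_i
-- are exactly 𝒫_{S|V^i}, and adding v_i is a bijection from 𝒫_{S|V^i} onto the sets
-- containing v_i. All these sets meet V₁ in S, so adding v_i moves the edges between v_i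
-- and V₁ ∖ S into the cut and those between v_i and S out of it: the cut grows by exactly l.
module Submission where

open import Defs
open import Data.Bool using (Bool; true; false; not; _∧_; _∨_; _xor_; T)
open import Data.Bool.Properties using (T-∧; T-not-≡; ∧-assoc; ∧-zeroʳ; ∧-identityʳ)
open import Data.Bool.ListAction using (and; any)
open import Data.Nat using (ℕ; suc; _+_; _*_; _≤_; _<_; _≡ᵇ_; _≤ᵇ_; _<?_; z≤n; s≤s)
open import Data.Nat.Properties
  using (+-suc; +-comm; *-identityʳ; m≤n⇒m≤1+n; ≤-refl; <⇒≤; <-irrefl; ≤∧≢⇒<; ≤ᵇ⇒≤; ≤⇒≤ᵇ; ≡ᵇ⇒≡; ≡⇒≡ᵇ)
open import Data.Nat.Tactic.RingSolver using (solve-∀)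
open import Data.Integer as ℤ using (ℤ; +_; -[1+_])
open import Data.Integer.Properties using (pos-+; +-assoc; +-injective)
open import Data.Integer.Tactic.RingSolver using () renaming (solve-∀ to solveℤ-∀)
open import Data.Fin using (Fin; toℕ; fromℕ<) renaming (_≟_ to _≟ᶠ_)
open import Data.Fin.Properties using (toℕ-injective; toℕ-fromℕ<)
open import Data.List using (List; []; _∷_; map; _++_; length; filterᵇ; allFin; cartesianProduct)
open import Data.List.Properties using (length-++; filter-++; map-cong; map-tabulate)
open import Data.List.Membership.Propositional using (_∈_; lose)
open import Data.List.Membership.Propositional.Properties using (∈-allFin; ∈-map⁺; ∈-++⁺ˡ; ∈-++⁺ʳ)
open import Data.List.Relation.Unary.All as All using ()
open import Data.List.Relation.Unary.All.Properties using (all⁺; all⁻)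
open import Data.List.Relation.Unary.Any using (satisfied)
open import Data.List.Relation.Unary.Any.Properties using (any⁺; any⁻)
open import Data.Vec using (Vec; _∷_; lookup; _[_]≔_)
open import Data.Vec.Properties
  using (lookup∘tabulate; lookup-replicate; tabulate∘lookup; tabulate-cong; lookup∘update; lookup∘update′)
open import Data.Sum using (inj₁; inj₂)
open import Data.Sum.Properties using (≡-dec)
open import Data.Product using (_×_; _,_; proj₁; proj₂; ∃-syntax)
open import Data.Empty using (⊥-elim)
open import Function using (_∘_; _⇔_; mk⇔; Equivalence)
open import Function.Definitions using (Injective)
open import Relation.Nullary using (yes; no)
open import Relation.Nullary.Decidable using (⌊_⌋; T?; toWitness; fromWitness)
open import Relation.Binary.PropositionalEquality

private variable A B : Set

T-ext : {x y : Bool} → (T x → T y) → (T y → T x) → x ≡ y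
T-ext {false} {false} _   _   = refl
T-ext {false} {true}  _   y⇒x = ⊥-elim (y⇒x _)
T-ext {true}  {false} x⇒y _   = ⊥-elim (x⇒y _)
T-ext {true}  {true}  _   _   = refl

∧-congˡ-T : (p : Bool) {b b′ : Bool} → (T p → b ≡ b′) → p ∧ b ≡ p ∧ b′
∧-congˡ-T false _    = refl
∧-congˡ-T true  b≡b′ = b≡b′ _

countᵇ-cong : {p q : A → Bool} (xs : List A) → (∀ x → p x ≡ q x) → countᵇ p xs ≡ countᵇ q xs
countᵇ-cong [] _ = refl
countᵇ-cong {p = p} {q} (x ∷ xs) p≗q with p x | q x | p≗q x
... | true  | true  | _ = cong suc (countᵇ-cong xs p≗q)
... | false | false | _ = countᵇ-cong xs p≗q

countᵇ-false : (xs : List A) → countᵇ (λ _ → false) xs ≡ 0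
countᵇ-false []       = refl
countᵇ-false (_ ∷ xs) = countᵇ-false xs

countᵇ-mono : {p q : A → Bool} (xs : List A) → (∀ x → T (p x) → T (q x)) → countᵇ p xs ≤ countᵇ q xs
countᵇ-mono [] _ = z≤n
countᵇ-mono {p = p} {q} (x ∷ xs) p⇒q with p x | q x | p⇒q x
... | true  | true  | _      = s≤s (countᵇ-mono xs p⇒q)
... | true  | false | p⇒q-x = ⊥-elim (p⇒q-x _)
... | false | true  | _      = m≤n⇒m≤1+n (countᵇ-mono xs p⇒q)
... | false | false | _      = countᵇ-mono xs p⇒q

countᵇ-++ : (p : A → Bool) (xs ys : List A) → countᵇ p (xs ++ ys) ≡ countᵇ p xs + countᵇ p ys
countᵇ-++ p xs ys = trans (cong length (filter-++ (T? ∘ p) xs ys)) (length-++ (filterᵇ p xs))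

countᵇ-map : (p : B → Bool) (f : A → B) (xs : List A) → countᵇ p (map f xs) ≡ countᵇ (p ∘ f) xs
countᵇ-map p f [] = refl
countᵇ-map p f (x ∷ xs) with p (f x)
... | true  = cong suc (countᵇ-map p f xs)
... | false = countᵇ-map p f xs

countᵇ-split : (q r : A → Bool) (xs : List A) →
               countᵇ r xs ≡ countᵇ (λ x → q x ∧ r x) xs + countᵇ (λ x → not (q x) ∧ r x) xs
countᵇ-split q r [] = refl
countᵇ-split q r (x ∷ xs) with q x | r x
... | true  | true  = cong suc (countᵇ-split q r xs)
... | false | true  = trans (cong suc (countᵇ-split q r xs)) (sym (+-suc _ _))
... | true  | false = countᵇ-split q r xs
... | false | false = countᵇ-split q r xs

countᵇ-cartesianProduct-∷ : (p : A × B → Bool) (x : A) (xs : List A) (ys : List B) →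
  countᵇ p (cartesianProduct (x ∷ xs) ys) ≡ countᵇ (λ y → p (x , y)) ys + countᵇ p (cartesianProduct xs ys)
countᵇ-cartesianProduct-∷ p x xs ys =
  trans (countᵇ-++ p (map (x ,_) ys) _) (cong (_+ _) (countᵇ-map p (x ,_) ys))

countᵇ-cartesianProduct-cong : {p q : A × B → Bool} (xs : List A) (ys : List B) →
  (∀ x → countᵇ (λ y → p (x , y)) ys ≡ countᵇ (λ y → q (x , y)) ys) →
  countᵇ p (cartesianProduct xs ys) ≡ countᵇ q (cartesianProduct xs ys)
countᵇ-cartesianProduct-cong [] ys _ = refl
countᵇ-cartesianProduct-cong {p = p} {q} (x ∷ xs) ys fibres = begin
  countᵇ p (cartesianProduct (x ∷ xs) ys)                          ≡⟨ countᵇ-cartesianProduct-∷ p x xs ys ⟩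
  countᵇ (λ y → p (x , y)) ys + countᵇ p (cartesianProduct xs ys)  ≡⟨ cong₂ _+_ (fibres x) (countᵇ-cartesianProduct-cong xs ys fibres) ⟩
  countᵇ (λ y → q (x , y)) ys + countᵇ q (cartesianProduct xs ys)  ≡⟨ countᵇ-cartesianProduct-∷ q x xs ys ⟨
  countᵇ q (cartesianProduct (x ∷ xs) ys)                          ∎
  where open ≡-Reasoning

countᵇ-cartesianProduct-∧ : (p : A → Bool) (q : B → Bool) (xs : List A) (ys : List B) →
  countᵇ (λ xy → p (proj₁ xy) ∧ q (proj₂ xy)) (cartesianProduct xs ys) ≡ countᵇ p xs * countᵇ q ys
countᵇ-cartesianProduct-∧ p q [] ys = refl
countᵇ-cartesianProduct-∧ p q (x ∷ xs) ys
  rewrite countᵇ-cartesianProduct-∷ (λ xy → p (proj₁ xy) ∧ q (proj₂ xy)) x xs ys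
        | countᵇ-cartesianProduct-∧ p q xs ys
  with p x
... | true  = refl
... | false = cong (_+ countᵇ p xs * countᵇ q ys) (countᵇ-false ys)

allFin-suc : (n : ℕ) → allFin (suc n) ≡ Fin.zero ∷ map Fin.suc (allFin n)
allFin-suc n = cong (Fin.zero ∷_) (sym (map-tabulate (λ b → b) Fin.suc))

countᵇ-≟ : {n : ℕ} (j : Fin n) → countᵇ (λ b → ⌊ b ≟ᶠ j ⌋) (allFin n) ≡ 1
countᵇ-≟ {suc n} j = trans (cong (countᵇ (λ b → ⌊ b ≟ᶠ j ⌋)) (allFin-suc n)) (at j)
  where
  suc≟suc : (j b : Fin n) → ⌊ Fin.suc b ≟ᶠ Fin.suc j ⌋ ≡ ⌊ b ≟ᶠ j ⌋
  suc≟suc j b with b ≟ᶠ j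
  ... | yes _ = refl
  ... | no  _ = refl
  at : (j : Fin (suc n)) → countᵇ (λ b → ⌊ b ≟ᶠ j ⌋) (Fin.zero ∷ map Fin.suc (allFin n)) ≡ 1
  at Fin.zero    = cong suc (trans (countᵇ-map _ Fin.suc (allFin n)) (countᵇ-false (allFin n)))
  at (Fin.suc j) =
    trans (countᵇ-map _ Fin.suc (allFin n)) (trans (countᵇ-cong (allFin n) (suc≟suc j)) (countᵇ-≟ j))

countᵇ-column : {m n : ℕ} (j : Fin n) (h : Fin m × Fin n → Bool) (f : Fin m → Bool) → (∀ a → h (a , j) ≡ f a) →
  countᵇ (λ ab → ⌊ proj₂ ab ≟ᶠ j ⌋ ∧ h ab) (cartesianProduct (allFin m) (allFin n)) ≡ countᵇ f (allFin m)
countᵇ-column {m} {n} j h f h≡f = begin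
  countᵇ (λ ab → ⌊ proj₂ ab ≟ᶠ j ⌋ ∧ h ab) (cartesianProduct (allFin m) (allFin n))
    ≡⟨ countᵇ-cong (cartesianProduct (allFin m) (allFin n)) on-column ⟩
  countᵇ (λ ab → f (proj₁ ab) ∧ ⌊ proj₂ ab ≟ᶠ j ⌋) (cartesianProduct (allFin m) (allFin n))
    ≡⟨ countᵇ-cartesianProduct-∧ f (λ b → ⌊ b ≟ᶠ j ⌋) (allFin m) (allFin n) ⟩
  countᵇ f (allFin m) * countᵇ (λ b → ⌊ b ≟ᶠ j ⌋) (allFin n)
    ≡⟨ cong (countᵇ f (allFin m) *_) (countᵇ-≟ j) ⟩
  countᵇ f (allFin m) * 1
    ≡⟨ *-identityʳ _ ⟩
  countᵇ f (allFin m) ∎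
  where
  open ≡-Reasoning
  on-column : ∀ ab → ⌊ proj₂ ab ≟ᶠ j ⌋ ∧ h ab ≡ f (proj₁ ab) ∧ ⌊ proj₂ ab ≟ᶠ j ⌋
  on-column (a , b) with b ≟ᶠ j
  ... | yes refl = trans (h≡f a) (sym (∧-identityʳ (f a)))
  ... | no  _    = sym (∧-zeroʳ (f a))

countᵇ-allVecs-suc : {n : ℕ} (p : Vec Bool (suc n) → Bool) →
  countᵇ p (allVecs (suc n)) ≡ countᵇ (p ∘ (true ∷_)) (allVecs n) + countᵇ (p ∘ (false ∷_)) (allVecs n)
countᵇ-allVecs-suc {n} p =
  trans (countᵇ-++ p (map (true ∷_) (allVecs n)) _)
        (cong₂ _+_ (countᵇ-map p (true ∷_) (allVecs n)) (countᵇ-map p (false ∷_) (allVecs n)))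

countᵇ-allVecs-set : (n : ℕ) (j : Fin n) (p : Vec Bool n → Bool) →
  countᵇ (λ B → lookup B j ∧ p B) (allVecs n) ≡ countᵇ (λ B → not (lookup B j) ∧ p (B [ j ]≔ true)) (allVecs n)
countᵇ-allVecs-set (suc n) Fin.zero p = begin
  countᵇ (λ B → lookup B Fin.zero ∧ p B) (allVecs (suc n))
    ≡⟨ countᵇ-allVecs-suc (λ B → lookup B Fin.zero ∧ p B) ⟩
  countᵇ (p ∘ (true ∷_)) (allVecs n) + countᵇ (λ _ → false) (allVecs n)
    ≡⟨ +-comm _ (countᵇ (λ _ → false) (allVecs n)) ⟩
  countᵇ (λ _ → false) (allVecs n) + countᵇ (p ∘ (true ∷_)) (allVecs n)
    ≡⟨ countᵇ-allVecs-suc (λ B → not (lookup B Fin.zero) ∧ p (B [ Fin.zero ]≔ true)) ⟨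
  countᵇ (λ B → not (lookup B Fin.zero) ∧ p (B [ Fin.zero ]≔ true)) (allVecs (suc n)) ∎
  where open ≡-Reasoning
countᵇ-allVecs-set (suc n) (Fin.suc j) p = begin
  countᵇ (λ B → lookup B (Fin.suc j) ∧ p B) (allVecs (suc n))
    ≡⟨ countᵇ-allVecs-suc (λ B → lookup B (Fin.suc j) ∧ p B) ⟩
  countᵇ (λ B → lookup B j ∧ p (true ∷ B)) (allVecs n) + countᵇ (λ B → lookup B j ∧ p (false ∷ B)) (allVecs n)
    ≡⟨ cong₂ _+_ (countᵇ-allVecs-set n j (p ∘ (true ∷_))) (countᵇ-allVecs-set n j (p ∘ (false ∷_))) ⟩
  countᵇ (λ B → not (lookup B j) ∧ p (true ∷ B [ j ]≔ true)) (allVecs n)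
    + countᵇ (λ B → not (lookup B j) ∧ p (false ∷ B [ j ]≔ true)) (allVecs n)
    ≡⟨ countᵇ-allVecs-suc (λ B → not (lookup B (Fin.suc j)) ∧ p (B [ Fin.suc j ]≔ true)) ⟨
  countᵇ (λ B → not (lookup B (Fin.suc j)) ∧ p (B [ Fin.suc j ]≔ true)) (allVecs (suc n)) ∎
  where open ≡-Reasoning

module _ {n : ℕ} where

  insert₂ : Fin n → Sub n → Sub n
  insert₂ j (A , B) = A , B [ j ]≔ true

  countᵇ-allSubs-insert₂ : (j : Fin n) (p : Sub n → Bool) →
    countᵇ (λ X → (inj₂ j ∈ᵇ X) ∧ p X) (allSubs n) ≡ countᵇ (λ X → not (inj₂ j ∈ᵇ X) ∧ p (insert₂ j X)) (allSubs n)
  countᵇ-allSubs-insert₂ j p =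
    countᵇ-cartesianProduct-cong (allVecs n) (allVecs n) (λ A → countᵇ-allVecs-set n j (λ B → p (A , B)))

  ∈ᵇ-insert₂ : (j : Fin n) (X : Sub n) {v : Vtx n} → v ≢ inj₂ j → v ∈ᵇ insert₂ j X ≡ v ∈ᵇ X
  ∈ᵇ-insert₂ j (A , B) {inj₁ a} _   = refl
  ∈ᵇ-insert₂ j (A , B) {inj₂ b} b≢j = lookup∘update′ (b≢j ∘ cong inj₂) B true

  ∈-allVtx : (v : Vtx n) → v ∈ allVtx n
  ∈-allVtx (inj₁ a) = ∈-++⁺ˡ (∈-map⁺ inj₁ (∈-allFin a))
  ∈-allVtx (inj₂ b) = ∈-++⁺ʳ (map inj₁ (allFin n)) (∈-map⁺ inj₂ (∈-allFin b))

  admits : Sub n → Sub n → Sub n → Vtx n → Bool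
  admits S' V' X v = (not (v ∈ᵇ S') ∨ (v ∈ᵇ X)) ∧ (not ((v ∈ᵇ V') ∧ not (v ∈ᵇ S')) ∨ not (v ∈ᵇ X))

  inP⇒admits : (S' V' X : Sub n) → T (inP S' V' X) → ∀ v → T (admits S' V' X v)
  inP⇒admits S' V' X h v = All.lookup (all⁺ (admits S' V' X) (allVtx n) h) (∈-allVtx v)

  admits⇒inP : (S' V' X : Sub n) → (∀ v → T (admits S' V' X v)) → T (inP S' V' X)
  admits⇒inP S' V' X h = all⁻ (admits S' V' X) {allVtx n} (All.tabulate (λ {v} _ → h v))

  admits-unconstrained : (S' V' X : Sub n) (v : Vtx n) → v ∈ᵇ S' ≡ false → v ∈ᵇ V' ≡ false →
                         admits S' V' X v ≡ true
  admits-unconstrained S' V' X v v∉S' v∉V' rewrite v∉S' | v∉V' = refl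

  admits-excluded : (S' V' X : Sub n) (v : Vtx n) → v ∈ᵇ S' ≡ false → v ∈ᵇ V' ≡ true →
                    admits S' V' X v ≡ not (v ∈ᵇ X)
  admits-excluded S' V' X v v∉S' v∈V' rewrite v∉S' | v∈V' = refl

  inP-insert₂ : {S' V' : Sub n} (j : Fin n) (X : Sub n) → inj₂ j ∈ᵇ S' ≡ false → inj₂ j ∈ᵇ V' ≡ false →
                inP S' V' (insert₂ j X) ≡ inP S' V' X
  inP-insert₂ {S'} {V'} j X j∉S' j∉V' = cong and (map-cong same-admits (allVtx n))
    where
    same-admits : ∀ v → admits S' V' (insert₂ j X) v ≡ admits S' V' X v
    same-admits v with ≡-dec _≟ᶠ_ _≟ᶠ_ v (inj₂ j)
    ... | yes refl = trans (admits-unconstrained S' V' (insert₂ j X) (inj₂ j) j∉S' j∉V')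
                           (sym (admits-unconstrained S' V' X (inj₂ j) j∉S' j∉V'))
    ... | no  v≢j  = cong (λ b → (not (v ∈ᵇ S') ∨ b) ∧ (not ((v ∈ᵇ V') ∧ not (v ∈ᵇ S')) ∨ not b))
                          (∈ᵇ-insert₂ j X v≢j)

  inP-unconstrain : {S' V' V'' : Sub n} (u : Vtx n) (X : Sub n) →
    u ∈ᵇ S' ≡ false → u ∈ᵇ V' ≡ true → u ∈ᵇ V'' ≡ false → (∀ v → v ≢ u → v ∈ᵇ V' ≡ v ∈ᵇ V'') →
    inP S' V' X ≡ not (u ∈ᵇ X) ∧ inP S' V'' X
  inP-unconstrain {S'} {V'} {V''} u X u∉S' u∈V' u∉V'' agree = T-ext constrained⇒free free⇒constrained
    where
    admits-agree : ∀ v → v ≢ u → admits S' V' X v ≡ admits S' V'' X v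
    admits-agree v v≢u =
      cong (λ b → (not (v ∈ᵇ S') ∨ (v ∈ᵇ X)) ∧ (not (b ∧ not (v ∈ᵇ S')) ∨ not (v ∈ᵇ X))) (agree v v≢u)
    constrained⇒free : T (inP S' V' X) → T (not (u ∈ᵇ X) ∧ inP S' V'' X)
    constrained⇒free h = Equivalence.from T-∧
      (subst T (admits-excluded S' V' X u u∉S' u∈V') (inP⇒admits S' V' X h u) , admits⇒inP S' V'' X at)
      where
      at : ∀ v → T (admits S' V'' X v)
      at v with ≡-dec _≟ᶠ_ _≟ᶠ_ v u
      ... | yes refl = subst T (sym (admits-unconstrained S' V'' X u u∉S' u∉V'')) _
      ... | no  v≢u  = subst T (admits-agree v v≢u) (inP⇒admits S' V' X h v)
    free⇒constrained : T (not (u ∈ᵇ X) ∧ inP S' V'' X) → T (inP S' V' X)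
    free⇒constrained h with Equivalence.to T-∧ h
    ... | u∉X , h'' = admits⇒inP S' V' X at
      where
      at : ∀ v → T (admits S' V' X v)
      at v with ≡-dec _≟ᶠ_ _≟ᶠ_ v u
      ... | yes refl = subst T (sym (admits-excluded S' V' X u u∉S' u∈V')) u∉X
      ... | no  v≢u  = subst T (sym (admits-agree v v≢u)) (inP⇒admits S' V'' X h'' v)

  countᵇ-inP-unconstrain : (S' V' V'' : Sub n) (j : Fin n) (f : Sub n → Bool) →
    inj₂ j ∈ᵇ S' ≡ false → inj₂ j ∈ᵇ V' ≡ true → inj₂ j ∈ᵇ V'' ≡ false →
    (∀ v → v ≢ inj₂ j → v ∈ᵇ V' ≡ v ∈ᵇ V'') →
    countᵇ (λ X → inP S' V'' X ∧ f X) (allSubs n)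
      ≡ countᵇ (λ X → inP S' V' X ∧ f (insert₂ j X)) (allSubs n) + countᵇ (λ X → inP S' V' X ∧ f X) (allSubs n)
  countᵇ-inP-unconstrain S' V' V'' j f j∉S' j∈V' j∉V'' agree = begin
    countᵇ (λ X → inP S' V'' X ∧ f X) (allSubs n)
      ≡⟨ countᵇ-split (inj₂ j ∈ᵇ_) (λ X → inP S' V'' X ∧ f X) (allSubs n) ⟩
    countᵇ (λ X → (inj₂ j ∈ᵇ X) ∧ (inP S' V'' X ∧ f X)) (allSubs n) + without-j
      ≡⟨ cong (_+ without-j) (countᵇ-allSubs-insert₂ j (λ X → inP S' V'' X ∧ f X)) ⟩
    countᵇ (λ X → not (inj₂ j ∈ᵇ X) ∧ (inP S' V'' (insert₂ j X) ∧ f (insert₂ j X))) (allSubs n) + without-j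
      ≡⟨ cong₂ _+_ (countᵇ-cong (allSubs n) added) (countᵇ-cong (allSubs n) kept) ⟩
    countᵇ (λ X → inP S' V' X ∧ f (insert₂ j X)) (allSubs n) + countᵇ (λ X → inP S' V' X ∧ f X) (allSubs n) ∎
    where
    open ≡-Reasoning
    without-j : ℕ
    without-j = countᵇ (λ X → not (inj₂ j ∈ᵇ X) ∧ (inP S' V'' X ∧ f X)) (allSubs n)
    constrain : ∀ X → not (inj₂ j ∈ᵇ X) ∧ inP S' V'' X ≡ inP S' V' X
    constrain X = sym (inP-unconstrain (inj₂ j) X j∉S' j∈V' j∉V'' agree)
    added : ∀ X → not (inj₂ j ∈ᵇ X) ∧ (inP S' V'' (insert₂ j X) ∧ f (insert₂ j X)) ≡ inP S' V' X ∧ f (insert₂ j X)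
    added X = begin
      not (inj₂ j ∈ᵇ X) ∧ (inP S' V'' (insert₂ j X) ∧ f (insert₂ j X))
        ≡⟨ ∧-assoc (not (inj₂ j ∈ᵇ X)) _ _ ⟨
      (not (inj₂ j ∈ᵇ X) ∧ inP S' V'' (insert₂ j X)) ∧ f (insert₂ j X)
        ≡⟨ cong (λ b → (not (inj₂ j ∈ᵇ X) ∧ b) ∧ f (insert₂ j X)) (inP-insert₂ j X j∉S' j∉V'') ⟩
      (not (inj₂ j ∈ᵇ X) ∧ inP S' V'' X) ∧ f (insert₂ j X)
        ≡⟨ cong (_∧ f (insert₂ j X)) (constrain X) ⟩
      inP S' V' X ∧ f (insert₂ j X) ∎
    kept : ∀ X → not (inj₂ j ∈ᵇ X) ∧ (inP S' V'' X ∧ f X) ≡ inP S' V' X ∧ f X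
    kept X = trans (sym (∧-assoc (not (inj₂ j ∈ᵇ X)) _ _)) (cong (_∧ f X) (constrain X))

  inP-embed₁ : (S : Vec Bool n) (V' X : Sub n) → (∀ a → inj₁ a ∈ᵇ V' ≡ true) →
               T (inP (embed₁ S) V' X) → proj₁ X ≡ S
  inP-embed₁ S V' (A , B) V₁⊆V' h =
    trans (sym (tabulate∘lookup A)) (trans (tabulate-cong agree) (tabulate∘lookup S))
    where
    fixed : ∀ s x → T ((not s ∨ x) ∧ (not (true ∧ not s) ∨ not x)) → x ≡ s
    fixed false false _ = refl
    fixed true  true  _ = refl
    agree : ∀ a → lookup A a ≡ lookup S a
    agree a = fixed (lookup S a) (lookup A a)
      (subst (λ b → T ((not (lookup S a) ∨ lookup A a) ∧ (not (b ∧ not (lookup S a)) ∨ not (lookup A a))))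
             (V₁⊆V' a) (inP⇒admits (embed₁ S) V' (A , B) h (inj₁ a)))

module _ {n : ℕ} (ord : Fin n → Fin n) where

  Vsup-∈₁ : (t : ℕ) (a : Fin n) → inj₁ a ∈ᵇ Vsup ord t ≡ true
  Vsup-∈₁ t a = lookup-replicate a true

  Vsup-∈₂ : (t : ℕ) (b : Fin n) → T (inj₂ b ∈ᵇ Vsup ord t) ⇔ (∃[ j ] t ≤ toℕ j × ord j ≡ b)
  Vsup-∈₂ t b = mk⇔ to from
    where
    P : Fin n → Bool
    P j = (t ≤ᵇ toℕ j) ∧ ⌊ ord j ≟ᶠ b ⌋
    unfold : inj₂ b ∈ᵇ Vsup ord t ≡ any P (allFin n)
    unfold = lookup∘tabulate (λ b → any (λ j → (t ≤ᵇ toℕ j) ∧ ⌊ ord j ≟ᶠ b ⌋) (allFin n)) b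
    to : T (inj₂ b ∈ᵇ Vsup ord t) → ∃[ j ] t ≤ toℕ j × ord j ≡ b
    to h with satisfied (any⁻ P (allFin n) (subst T unfold h))
    ... | j , Pj with Equivalence.to T-∧ Pj
    ...   | t≤j , ordj≡b = j , ≤ᵇ⇒≤ t (toℕ j) t≤j , toWitness ordj≡b
    from : ∃[ j ] t ≤ toℕ j × ord j ≡ b → T (inj₂ b ∈ᵇ Vsup ord t)
    from (j , t≤j , ordj≡b) =
      subst T (sym unfold) (any⁺ P (lose (∈-allFin j) (Equivalence.from T-∧ (≤⇒≤ᵇ t≤j , fromWitness ordj≡b))))

  Vsup-∈-own : (i : Fin n) → inj₂ (ord i) ∈ᵇ Vsup ord (toℕ i) ≡ true
  Vsup-∈-own i = T-ext _ (λ _ → Equivalence.from (Vsup-∈₂ (toℕ i) (ord i)) (i , ≤-refl , refl))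

  Vsup-∉-own : Injective _≡_ _≡_ ord → (i : Fin n) → inj₂ (ord i) ∈ᵇ Vsup ord (suc (toℕ i)) ≡ false
  Vsup-∉-own ord-inj i = T-ext absurd (λ ())
    where
    absurd : T (inj₂ (ord i) ∈ᵇ Vsup ord (suc (toℕ i))) → T false
    absurd h with Equivalence.to (Vsup-∈₂ (suc (toℕ i)) (ord i)) h
    ... | j , i<j , ordj≡ordi rewrite ord-inj ordj≡ordi = <-irrefl refl i<j

  Vsup-suc : (i : Fin n) (v : Vtx n) → v ≢ inj₂ (ord i) → v ∈ᵇ Vsup ord (toℕ i) ≡ v ∈ᵇ Vsup ord (suc (toℕ i))
  Vsup-suc i (inj₁ a) _ = trans (Vsup-∈₁ (toℕ i) a) (sym (Vsup-∈₁ (suc (toℕ i)) a))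
  Vsup-suc i (inj₂ b) b≢ordi = T-ext
    (λ h → Equivalence.from (Vsup-∈₂ (suc (toℕ i)) b) (strict (Equivalence.to (Vsup-∈₂ (toℕ i) b) h)))
    (λ h → Equivalence.from (Vsup-∈₂ (toℕ i) b) (weak (Equivalence.to (Vsup-∈₂ (suc (toℕ i)) b) h)))
    where
    strict : ∃[ j ] toℕ i ≤ toℕ j × ord j ≡ b → ∃[ j ] suc (toℕ i) ≤ toℕ j × ord j ≡ b
    strict (j , i≤j , ordj≡b) =
      j , ≤∧≢⇒< i≤j (λ i≡j → b≢ordi (cong inj₂ (trans (sym ordj≡b) (cong ord (toℕ-injective (sym i≡j)))))) , ordj≡b
    weak : ∃[ j ] suc (toℕ i) ≤ toℕ j × ord j ≡ b → ∃[ j ] toℕ i ≤ toℕ j × ord j ≡ b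
    weak (j , i<j , ordj≡b) = j , <⇒≤ i<j , ordj≡b

module _ {n : ℕ} (E : Graph n) where

  degIn degOut : Vec Bool n → Fin n → ℕ
  degIn  A j = countᵇ (λ a → E a j ∧ lookup A a) (allFin n)
  degOut A j = countᵇ (λ a → E a j ∧ not (lookup A a)) (allFin n)

  cutSize-insert₂ : (A B : Vec Bool n) (j : Fin n) → lookup B j ≡ false →
    cutSize E (insert₂ j (A , B)) + degIn A j ≡ cutSize E (A , B) + degOut A j
  cutSize-insert₂ A B j j∉B = begin
    cutSize E (A , B′) + degIn A j
      ≡⟨ cong (_+ degIn A j) (countᵇ-split onColumn (crosses B′) pairs) ⟩
    countᵇ (λ ab → onColumn ab ∧ crosses B′ ab) pairs + offColumn B′ + degIn A j
      ≡⟨ cong (λ c → c + offColumn B′ + degIn A j) (countᵇ-column j (crosses B′) _ crosses-B′-at-j) ⟩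
    degOut A j + offColumn B′ + degIn A j
      ≡⟨ cong (λ c → degOut A j + c + degIn A j) (countᵇ-cong pairs same-off-column) ⟩
    degOut A j + offColumn B + degIn A j
      ≡⟨ swap-ends (degOut A j) (offColumn B) (degIn A j) ⟩
    degIn A j + offColumn B + degOut A j
      ≡⟨ cong (λ c → c + offColumn B + degOut A j) (countᵇ-column j (crosses B) _ crosses-B-at-j) ⟨
    countᵇ (λ ab → onColumn ab ∧ crosses B ab) pairs + offColumn B + degOut A j
      ≡⟨ cong (_+ degOut A j) (countᵇ-split onColumn (crosses B) pairs) ⟨
    cutSize E (A , B) + degOut A j ∎
    where
    open ≡-Reasoning
    B′ = B [ j ]≔ true
    pairs = cartesianProduct (allFin n) (allFin n)
    crosses : Vec Bool n → Fin n × Fin n → Bool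
    crosses C ab = E (proj₁ ab) (proj₂ ab) ∧ (lookup A (proj₁ ab) xor lookup C (proj₂ ab))
    onColumn : Fin n × Fin n → Bool
    onColumn ab = ⌊ proj₂ ab ≟ᶠ j ⌋
    offColumn : Vec Bool n → ℕ
    offColumn C = countᵇ (λ ab → not (onColumn ab) ∧ crosses C ab) pairs
    swap-ends : ∀ x r y → x + r + y ≡ y + r + x
    swap-ends = solve-∀
    xor-false : ∀ x → x xor false ≡ x
    xor-false false = refl
    xor-false true  = refl
    xor-true : ∀ x → x xor true ≡ not x
    xor-true false = refl
    xor-true true  = refl
    crosses-B-at-j : ∀ a → crosses B (a , j) ≡ E a j ∧ lookup A a
    crosses-B-at-j a rewrite j∉B = cong (E a j ∧_) (xor-false (lookup A a))
    crosses-B′-at-j : ∀ a → crosses B′ (a , j) ≡ E a j ∧ not (lookup A a)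
    crosses-B′-at-j a rewrite lookup∘update j B true = cong (E a j ∧_) (xor-true (lookup A a))
    same-off-column : ∀ ab → not (onColumn ab) ∧ crosses B′ ab ≡ not (onColumn ab) ∧ crosses B ab
    same-off-column (a , b) with b ≟ᶠ j
    ... | yes _ = refl
    ... | no b≢j rewrite lookup∘update′ b≢j B true = refl

  cutSize≤numEdges : (X : Sub n) → cutSize E X ≤ numEdges E
  cutSize≤numEdges X = countᵇ-mono (cartesianProduct (allFin n) (allFin n)) (λ _ → proj₁ ∘ Equivalence.to T-∧)

[a+b]-b≡a : ∀ (a b : ℤ) → (a ℤ.+ b) ℤ.- b ≡ a
[a+b]-b≡a = solveℤ-∀

[a-b]+b≡a : ∀ (a b : ℤ) → (a ℤ.- b) ℤ.+ b ≡ a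
[a-b]+b≡a = solveℤ-∀

pos-transpose : (x y c d : ℕ) → x + c ≡ y + d → + x ≡ + y ℤ.+ (+ d ℤ.- + c)
pos-transpose x y c d x+c≡y+d = begin
  + x                    ≡⟨ [a+b]-b≡a (+ x) (+ c) ⟨
  (+ x ℤ.+ + c) ℤ.- + c  ≡⟨ cong (ℤ._- + c) (trans (sym (pos-+ x c)) (trans (cong +_ x+c≡y+d) (pos-+ y d))) ⟩
  (+ y ℤ.+ + d) ℤ.- + c  ≡⟨ +-assoc (+ y) (+ d) (ℤ.- + c) ⟩
  + y ℤ.+ (+ d ℤ.- + c)  ∎
  where open ≡-Reasoning

module _ (xs : List A) (P : A → Bool) (c d : A → ℕ) (m : ℕ) (l : ℤ)
         (c≤m : ∀ x → T (P x) → c x ≤ m) (d≡c+l : ∀ x → T (P x) → + d x ≡ + c x ℤ.+ l) where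

  private
    d≡k⇒c≡k-l : ∀ x k → T (P x) → d x ≡ k → + c x ≡ + k ℤ.- l
    d≡k⇒c≡k-l x k Px refl = trans (sym ([a+b]-b≡a (+ c x) l)) (cong (ℤ._- l) (sym (d≡c+l x Px)))

    c≡k-l⇒d≡k : ∀ x k → T (P x) → + c x ≡ + k ℤ.- l → d x ≡ k
    c≡k-l⇒d≡k x k Px c≡k-l = +-injective (trans (d≡c+l x Px) (trans (cong (ℤ._+ l) c≡k-l) ([a-b]+b≡a (+ k) l)))

    countᵇ-none : ∀ k → (∀ x → T (P x) → d x ≢ k) → countᵇ (λ x → P x ∧ (d x ≡ᵇ k)) xs ≡ 0
    countᵇ-none k d≢k = trans (countᵇ-cong xs never) (countᵇ-false xs)
      where
      never : ∀ x → P x ∧ (d x ≡ᵇ k) ≡ false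
      never x = trans (∧-congˡ-T (P x) (λ Px → T-ext (λ d≡k → d≢k x Px (≡ᵇ⇒≡ (d x) k d≡k)) λ ())) (∧-zeroʳ (P x))

  -- The bound c ≤ m is what makes the truncation of σ at m harmless.
  countᵇ-σ : (k : Fin (suc m)) →
    countᵇ (λ x → P x ∧ (d x ≡ᵇ toℕ k)) xs ≡ σ m l (λ k′ → countᵇ (λ x → P x ∧ (c x ≡ᵇ toℕ k′)) xs) k
  countᵇ-σ k with (+ toℕ k) ℤ.- l in k-l≡
  ... | -[1+ t ] = countᵇ-none (toℕ k) λ x Px d≡k → pos≢neg (trans (d≡k⇒c≡k-l x (toℕ k) Px d≡k) k-l≡)
    where pos≢neg : ∀ {y} → + y ≢ -[1+ t ]
          pos≢neg ()
  ... | + j with j <? suc m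
  ...   | yes j≤m = countᵇ-cong xs λ x → ∧-congˡ-T (P x) λ Px → T-ext
            (λ d≡k → ≡⇒≡ᵇ (c x) _ (trans (+-injective (trans (d≡k⇒c≡k-l x (toℕ k) Px (≡ᵇ⇒≡ (d x) _ d≡k)) k-l≡))
                                         (sym (toℕ-fromℕ< j≤m))))
            (λ c≡j → ≡⇒≡ᵇ (d x) _ (c≡k-l⇒d≡k x (toℕ k) Px
                                     (trans (cong +_ (trans (≡ᵇ⇒≡ (c x) _ c≡j) (toℕ-fromℕ< j≤m))) (sym k-l≡))))
  ...   | no j>m = countᵇ-none (toℕ k) λ x Px d≡k →
            j>m (s≤s (subst (_≤ m) (+-injective (trans (d≡k⇒c≡k-l x (toℕ k) Px d≡k) k-l≡)) (c≤m x Px)))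

lemma4 : (n : ℕ) (E : Graph n) (ord : Fin n → Fin n) → Injective _≡_ _≡_ ord →
         (S : Vec Bool n) (i : Fin n) → suc (toℕ i) < n →
         (k : Fin (suc (numEdges E))) →
         W E (embed₁ S) (Vsup ord (suc (toℕ i))) k
           ≡ W E (embed₁ S) (Vsup ord (toℕ i)) k
             + σ (numEdges E) (ldiff E S (ord i)) (W E (embed₁ S) (Vsup ord (toℕ i))) k
lemma4 n E ord ord-inj S i _ k = begin
  W E S' Vⁱ⁺¹ k
    ≡⟨ countᵇ-inP-unconstrain S' Vⁱ Vⁱ⁺¹ vᵢ (λ X → cutSize E X ≡ᵇ toℕ k) vᵢ∉S'
         (Vsup-∈-own ord i) (Vsup-∉-own ord ord-inj i) (Vsup-suc ord i) ⟩
  countᵇ (λ X → inP S' Vⁱ X ∧ (cutSize E (insert₂ vᵢ X) ≡ᵇ toℕ k)) (allSubs n) + W E S' Vⁱ k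
    ≡⟨ cong (_+ W E S' Vⁱ k) (countᵇ-σ (allSubs n) (inP S' Vⁱ) (cutSize E) (cutSize E ∘ insert₂ vᵢ) (numEdges E)
                                        (ldiff E S vᵢ) (λ X _ → cutSize≤numEdges E X) shift k) ⟩
  σ (numEdges E) (ldiff E S vᵢ) (W E S' Vⁱ) k + W E S' Vⁱ k
    ≡⟨ +-comm _ (W E S' Vⁱ k) ⟩
  W E S' Vⁱ k + σ (numEdges E) (ldiff E S vᵢ) (W E S' Vⁱ) k ∎
  where
  open ≡-Reasoning
  S' = embed₁ S
  Vⁱ = Vsup ord (toℕ i)
  Vⁱ⁺¹ = Vsup ord (suc (toℕ i))
  vᵢ = ord i
  vᵢ∉S' : inj₂ vᵢ ∈ᵇ S' ≡ false
  vᵢ∉S' = lookup-replicate vᵢ false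
  shift : ∀ X → T (inP S' Vⁱ X) → + cutSize E (insert₂ vᵢ X) ≡ + cutSize E X ℤ.+ ldiff E S vᵢ
  shift (A , B) X∈𝒫 =
    subst (λ A′ → + cutSize E (insert₂ vᵢ (A , B)) ≡ + cutSize E (A , B) ℤ.+ ldiff E A′ vᵢ)
          (inP-embed₁ S Vⁱ (A , B) (Vsup-∈₁ ord (toℕ i)) X∈𝒫)
          (pos-transpose _ _ _ _ (cutSize-insert₂ E A B vᵢ vᵢ∉B))
    where
    vᵢ∉B : lookup B vᵢ ≡ false
    vᵢ∉B = Equivalence.to T-not-≡
      (subst T (admits-excluded S' Vⁱ (A , B) (inj₂ vᵢ) vᵢ∉S' (Vsup-∈-own ord i)) (inP⇒admits S' Vⁱ (A , B) X∈𝒫 (inj₂ vᵢ)))
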